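{- Let $\mathbf{B}\in\mathbb{C}^{n\times n\times n}$ be generic. Then the BM-rank of $\mathbf{B}$ is at most $2$ if $n=2$, and at most $n-1$ if $n>2$.
   Context: A generic hypermatrix is one whose entries do not satisfy any non-trivial algebraic relation (in particular all entries are nonzero). For conformable $\mathbf{A}^{(0)}\in\mathbb{C}^{n_0\times \ell\times n_2}$, $\mathbf{A}^{(1)}\in\mathbb{C}^{n_0\times n_1\times \ell}$, $\mathbf{A}^{(2)}\in\mathbb{C}^{\ell\times n_1\times n_2}$, the Bhattacharya-Mesner product is $\mathrm{Prod}(\mathbf{A}^{(0)},\mathbf{A}^{(1)},\mathbf{A}^{(2)})[i_0,i_1,i_2]=\sum_{0\le j<\ell}\mathbf{A}^{(0)}[i_0,j,i_2]\mathbf{A}^{(1)}[i_0,i_1,j]\mathbf{A}^{(2)}[j,i_1,i_2]$. The BM-rank of $\mathbf{A}$ is the least $r$ such that $\mathbf{A}=\mathrm{Prod}(\mathbf{X}^{(0)},\mathbf{X}^{(1)},\mathbf{X}^{(2)})$ with $\mathbf{X}^{(0)}\in\mathbb{C}^{n_0\times r\times n_2}$, $\mathbf{X}^{(1)}\in\mathbb{C}^{n_0\times n_1\times r}$, $\mathbf{X}^{(2)}\in\mathbb{C}^{r\times n_1\times n_2}$. -}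

module Defs where

open import Level using (Level)
open import Algebra.Bundles using (CommutativeRing)
open import Data.Nat as ℕ using (ℕ; zero; suc)
open import Data.Integer as ℤ using (ℤ; +_; -[1+_])
open import Data.Fin using (Fin)
open import Data.List using (List; []; _∷_; length)
open import Data.List.Relation.Unary.All using (All)
open import Data.List.Relation.Unary.AllPairs using (AllPairs)
open import Data.Product using (Σ; ∃; _×_; _,_; proj₁; proj₂)
open import Relation.Binary.PropositionalEquality using (_≡_; _≢_)
open import Relation.Nullary using (¬_)

module _ {c ℓ : Level} (R : CommutativeRing c ℓ) where
  open CommutativeRing R

  infixr 8 _^ᴿ_
  _^ᴿ_ : Carrier → ℕ → Carrier
  x ^ᴿ zero  = 1#
  x ^ᴿ suc k = x * (x ^ᴿ k)

  natᴿ : ℕ → Carrier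
  natᴿ zero    = 0#
  natᴿ (suc k) = 1# + natᴿ k

  intᴿ : ℤ → Carrier
  intᴿ (+ k)      = natᴿ k
  intᴿ -[1+ k ]   = - natᴿ (suc k)

  Σᶠ : (n : ℕ) → (Fin n → Carrier) → Carrier
  Σᶠ zero    f = 0#
  Σᶠ (suc n) f = f Fin.zero + Σᶠ n (λ i → f (Fin.suc i))
    where import Data.Fin as Fin

  Πᶠ : (n : ℕ) → (Fin n → Carrier) → Carrier
  Πᶠ zero    f = 1#
  Πᶠ (suc n) f = f Fin.zero * Πᶠ n (λ i → f (Fin.suc i))
    where import Data.Fin as Fin

  IsField : Set (c Level.⊔ ℓ)
  IsField = (¬ (1# ≈ 0#)) × (∀ x → ¬ (x ≈ 0#) → ∃ λ y → x * y ≈ 1#)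

  evalU : List Carrier → Carrier → Carrier
  evalU []       x = 0#
  evalU (a ∷ cs) x = a + x * evalU cs x

  IsAlgClosed : Set (c Level.⊔ ℓ)
  IsAlgClosed = (cs : List Carrier) (lead : Carrier) →
    1 ℕ.≤ length cs → ¬ (lead ≈ 0#) →
    ∃ λ x → evalU cs x + lead * (x ^ᴿ length cs) ≈ 0#

  Char0 : Set ℓ
  Char0 = ∀ k → natᴿ (suc k) ≈ 0# → Data.Empty.⊥
    where import Data.Empty

  HM : ℕ → ℕ → ℕ → Set c
  HM n₀ n₁ n₂ = Fin n₀ → Fin n₁ → Fin n₂ → Carrier

  Prod : ∀ {n₀ n₁ n₂ l} → HM n₀ l n₂ → HM n₀ n₁ l → HM l n₁ n₂ → HM n₀ n₁ n₂
  Prod {l = l} A₀ A₁ A₂ i₀ i₁ i₂ =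
    Σᶠ l (λ j → A₀ i₀ j i₂ * A₁ i₀ i₁ j * A₂ j i₁ i₂)

  _≈ᴴ_ : ∀ {n₀ n₁ n₂} → HM n₀ n₁ n₂ → HM n₀ n₁ n₂ → Set ℓ
  A ≈ᴴ B = ∀ i₀ i₁ i₂ → A i₀ i₁ i₂ ≈ B i₀ i₁ i₂

  BMRank≤ : ∀ {n₀ n₁ n₂} → HM n₀ n₁ n₂ → ℕ → Set (c Level.⊔ ℓ)
  BMRank≤ {n₀} {n₁} {n₂} A k =
    ∃ λ r → r ℕ.≤ k × Σ (HM n₀ r n₂) λ X₀ → Σ (HM n₀ n₁ r) λ X₁ →
      Σ (HM r n₁ n₂) λ X₂ → Prod X₀ X₁ X₂ ≈ᴴ A

  -- Genericity: the entries satisfy no non-trivial polynomial relation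
  -- with integer coefficients (algebraic independence over the prime field)

  Mono : ℕ → ℕ → ℕ → Set
  Mono n₀ n₁ n₂ = Fin n₀ → Fin n₁ → Fin n₂ → ℕ

  Poly : ℕ → ℕ → ℕ → Set
  Poly n₀ n₁ n₂ = List (ℤ × Mono n₀ n₁ n₂)

  NonZeroPoly : ∀ {n₀ n₁ n₂} → Poly n₀ n₁ n₂ → Set
  NonZeroPoly p =
    (p ≢ []) ×
    All (λ t → proj₁ t ≢ + 0) p ×
    AllPairs (λ t u → ¬ (∀ i j k → proj₂ t i j k ≡ proj₂ u i j k)) p

  evalMono : ∀ {n₀ n₁ n₂} → Mono n₀ n₁ n₂ → HM n₀ n₁ n₂ → Carrier
  evalMono {n₀} {n₁} {n₂} e A =
    Πᶠ n₀ λ i → Πᶠ n₁ λ j → Πᶠ n₂ λ k → A i j k ^ᴿ e i j k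

  evalPoly : ∀ {n₀ n₁ n₂} → Poly n₀ n₁ n₂ → HM n₀ n₁ n₂ → Carrier
  evalPoly []            A = 0#
  evalPoly ((a , e) ∷ p) A = intᴿ a * evalMono e A + evalPoly p A

  Generic : ∀ {n₀ n₁ n₂} → HM n₀ n₁ n₂ → Set ℓ
  Generic A = ∀ p → NonZeroPoly p → ¬ (evalPoly p A ≈ 0#)

-- Fix a frontal slice q of B.  Rows 2, …, n-1 pass through the inner indices
-- 1, …, n-2 unchanged, and inner index 0 carries a row T that agrees with row 0
-- on columns 0, 1 and with φ⁻¹·(row 1) elsewhere.  Row 1 is then φ·T plus v times
-- row 2 on columns 0 and 1, and row 0 is T corrected on each column c ≥ 2 by a
-- multiple of B[c,c].  The pair (φ, v) solves a 2×2 linear system whose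
-- determinant is a 2×2 minor of the slice, and φ ≠ 0 because another such minor
-- is nonzero.  Genericity supplies all of this: a vanishing entry is a monomial
-- relation, a vanishing 2×2 minor a binomial one.  For n = 2 the trivial
-- decomposition through the n rows suffices.
module Submission where

open import Defs
open import Level using (Level)
open import Algebra.Bundles using (CommutativeRing)
open import Data.Nat using (ℕ; _≤_; _∸_)
open import Data.Product using (_×_)
open import Relation.Binary.PropositionalEquality using (_≡_)

open import Data.Nat as ℕ using (zero; suc; s≤s)
open import Data.Nat.Properties using (≤-refl)
open import Data.Fin using (Fin; zero; suc)
open import Data.Fin.Patterns using (0F; 1F; 2F)
open import Data.Integer using (+_; -[1+_])
open import Data.List using ([]; _∷_)
open import Data.List.Relation.Unary.All using ([]; _∷_)
open import Data.List.Relation.Unary.AllPairs using ([]; _∷_)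
open import Data.Product using (∃; ∃₂; _,_; proj₁; proj₂)
open import Data.Empty using (⊥; ⊥-elim)
open import Relation.Nullary using (¬_)
open import Relation.Binary.PropositionalEquality using (_≢_)
import Relation.Binary.PropositionalEquality as ≡

kronecker : ∀ {a} {A : Set a} → A → A → ∀ {n} → Fin n → Fin n → A
kronecker one nil zero    zero    = one
kronecker one nil zero    (suc _) = nil
kronecker one nil (suc _) zero    = nil
kronecker one nil (suc x) (suc y) = kronecker one nil x y

kronecker-diag : ∀ {a} {A : Set a} {one nil : A} {n} (x : Fin n) →
                 kronecker one nil x x ≡ one
kronecker-diag zero    = ≡.refl
kronecker-diag (suc x) = kronecker-diag x

kronecker-off : ∀ {a} {A : Set a} {one nil : A} {n} {x y : Fin n} →
                x ≢ y → kronecker one nil x y ≡ nil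
kronecker-off {x = zero}  {zero}  x≢y = ⊥-elim (x≢y ≡.refl)
kronecker-off {x = zero}  {suc _} _   = ≡.refl
kronecker-off {x = suc _} {zero}  _   = ≡.refl
kronecker-off {x = suc x} {suc y} x≢y = kronecker-off (λ x≡y → x≢y (≡.cong suc x≡y))

module _ {c ℓ : Level} (K : CommutativeRing c ℓ) where
  open CommutativeRing K hiding (zero)
  open import Algebra.Properties.Ring ring
    using (+-cancelʳ; //-rightDividesˡ; x∙y⁻¹≈ε⇒x≈y; x≈y⇒x∙y⁻¹≈ε; -1*x≈-x)
  open import Algebra.Properties.CommutativeSemigroup *-commutativeSemigroup
    using (interchange; xy∙z≈y∙xz)
  open import Algebra.Solver.Ring.NaturalCoefficients.Default commutativeSemiring
    using (solve; _:=_; _:+_; _:*_)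
  open import Relation.Binary.Reasoning.Setoid setoid

  private
    x*1*y≈x*y : ∀ x y → x * 1# * y ≈ x * y
    x*1*y≈x*y x y = *-congʳ (*-identityʳ x)

    x*0*y≈0 : ∀ x y → x * 0# * y ≈ 0#
    x*0*y≈0 x y = trans (*-congʳ (zeroʳ x)) (zeroˡ y)

    0*x*y≈0 : ∀ x y → 0# * x * y ≈ 0#
    0*x*y≈0 x y = trans (*-congʳ (zeroˡ x)) (zeroˡ y)

  δ : ∀ {n} → Fin n → Fin n → Carrier
  δ = kronecker 1# 0#

  δℕ : ∀ {n} → Fin n → Fin n → ℕ
  δℕ = kronecker 1 0

  Σᶠ-cong : ∀ n {f g : Fin n → Carrier} → (∀ i → f i ≈ g i) → Σᶠ K n f ≈ Σᶠ K n g
  Σᶠ-cong zero    f≈g = refl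
  Σᶠ-cong (suc n) f≈g = +-cong (f≈g zero) (Σᶠ-cong n (λ i → f≈g (suc i)))

  Σᶠ-zero : ∀ n {f : Fin n → Carrier} → (∀ i → f i ≈ 0#) → Σᶠ K n f ≈ 0#
  Σᶠ-zero zero    f≈0 = refl
  Σᶠ-zero (suc n) f≈0 =
    trans (+-cong (f≈0 zero) (Σᶠ-zero n (λ i → f≈0 (suc i)))) (+-identityʳ 0#)

  Σᶠ-δ : ∀ {n} (i : Fin n) (f : Fin n → Carrier) → Σᶠ K n (λ j → δ j i * f j) ≈ f i
  Σᶠ-δ {suc n} zero f =
    trans (+-cong (*-identityˡ _) (Σᶠ-zero n (λ j → zeroˡ _))) (+-identityʳ _)
  Σᶠ-δ {suc n} (suc i) f =
    trans (+-cong (zeroˡ _) (Σᶠ-δ i (λ j → f (suc j)))) (+-identityˡ _)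

  Πᶠ-cong : ∀ n {f g : Fin n → Carrier} → (∀ i → f i ≈ g i) → Πᶠ K n f ≈ Πᶠ K n g
  Πᶠ-cong zero    f≈g = refl
  Πᶠ-cong (suc n) f≈g = *-cong (f≈g zero) (Πᶠ-cong n (λ i → f≈g (suc i)))

  Πᶠ-one : ∀ n {f : Fin n → Carrier} → (∀ i → f i ≈ 1#) → Πᶠ K n f ≈ 1#
  Πᶠ-one zero    f≈1 = refl
  Πᶠ-one (suc n) f≈1 =
    trans (*-cong (f≈1 zero) (Πᶠ-one n (λ i → f≈1 (suc i)))) (*-identityʳ 1#)

  Πᶠ-*-distrib : ∀ n (f g : Fin n → Carrier) →
                 Πᶠ K n (λ i → f i * g i) ≈ Πᶠ K n f * Πᶠ K n g
  Πᶠ-*-distrib zero    f g = sym (*-identityʳ 1#)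
  Πᶠ-*-distrib (suc n) f g =
    trans (*-congˡ (Πᶠ-*-distrib n (λ i → f (suc i)) (λ i → g (suc i))))
          (interchange (f zero) (g zero) _ _)

  Πᶠ-δ : ∀ {n} (i : Fin n) (F : Fin n → ℕ → Carrier) → (∀ j → F j 0 ≈ 1#) →
         Πᶠ K n (λ j → F j (δℕ i j)) ≈ F i 1
  Πᶠ-δ {suc n} zero F F0≈1 =
    trans (*-congˡ (Πᶠ-one n (λ j → F0≈1 (suc j)))) (*-identityʳ _)
  Πᶠ-δ {suc n} (suc i) F F0≈1 =
    trans (*-cong (F0≈1 zero) (Πᶠ-δ i (λ j → F (suc j)) (λ j → F0≈1 (suc j))))
          (*-identityˡ _)

  ^ᴿ-+ : ∀ x m n → _^ᴿ_ K x (m ℕ.+ n) ≈ _^ᴿ_ K x m * _^ᴿ_ K x n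
  ^ᴿ-+ x zero    n = sym (*-identityˡ _)
  ^ᴿ-+ x (suc m) n = trans (*-congˡ (^ᴿ-+ x m n)) (sym (*-assoc _ _ _))

  module _ {n₀ n₁ n₂ : ℕ} where

    _+ᵐ_ : Mono K n₀ n₁ n₂ → Mono K n₀ n₁ n₂ → Mono K n₀ n₁ n₂
    (e +ᵐ f) i j k = e i j k ℕ.+ f i j k

    unitMono : Fin n₀ → Fin n₁ → Fin n₂ → Mono K n₀ n₁ n₂
    unitMono x y z i j k = δℕ x i ℕ.* δℕ y j ℕ.* δℕ z k

    evalMono-+ᵐ : (e f : Mono K n₀ n₁ n₂) (A : HM K n₀ n₁ n₂) →
                  evalMono K (e +ᵐ f) A ≈ evalMono K e A * evalMono K f A
    evalMono-+ᵐ e f A =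
      trans (Πᶠ-cong n₀ λ i →
               trans (Πᶠ-cong n₁ λ j →
                        trans (Πᶠ-cong n₂ λ k → ^ᴿ-+ (A i j k) (e i j k) (f i j k))
                              (Πᶠ-*-distrib n₂ _ _))
                     (Πᶠ-*-distrib n₁ _ _))
            (Πᶠ-*-distrib n₀ _ _)

    evalMono-unitMono : (A : HM K n₀ n₁ n₂) (x : Fin n₀) (y : Fin n₁) (z : Fin n₂) →
                        evalMono K (unitMono x y z) A ≈ A x y z
    evalMono-unitMono A x y z = begin
      evalMono K (unitMono x y z) A
        ≈⟨ Πᶠ-δ x (λ i t → Πᶠ K n₁ λ j → Πᶠ K n₂ λ k →
                             _^ᴿ_ K (A i j k) (t ℕ.* δℕ y j ℕ.* δℕ z k))
                  (λ i → Πᶠ-one n₁ (λ j → Πᶠ-one n₂ (λ k → refl))) ⟩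
      (Πᶠ K n₁ λ j → Πᶠ K n₂ λ k → _^ᴿ_ K (A x j k) (1 ℕ.* δℕ y j ℕ.* δℕ z k))
        ≈⟨ Πᶠ-δ y (λ j t → Πᶠ K n₂ λ k → _^ᴿ_ K (A x j k) (1 ℕ.* t ℕ.* δℕ z k))
                  (λ j → Πᶠ-one n₂ (λ k → refl)) ⟩
      (Πᶠ K n₂ λ k → _^ᴿ_ K (A x y k) (1 ℕ.* 1 ℕ.* δℕ z k))
        ≈⟨ Πᶠ-δ z (λ k t → _^ᴿ_ K (A x y k) (1 ℕ.* 1 ℕ.* t)) (λ k → refl) ⟩
      A x y z * 1#
        ≈⟨ *-identityʳ _ ⟩
      A x y z ∎

    slice-minor-monomials-distinct :
      ∀ {i i' : Fin n₀} {j j' : Fin n₁} (q : Fin n₂) → i ≢ i' → j ≢ j' →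
      ¬ (∀ a b c → (unitMono i j q +ᵐ unitMono i' j' q) a b c
                 ≡ (unitMono i j' q +ᵐ unitMono i' j q) a b c)
    slice-minor-monomials-distinct {i} {i'} {j} {j'} q i≢i' j≢j' same =
      at-ijq (same i j q)
      where
      at-ijq : (unitMono i j q +ᵐ unitMono i' j' q) i j q
             ≡ (unitMono i j' q +ᵐ unitMono i' j q) i j q → ⊥
      at-ijq rewrite kronecker-diag {one = 1} {nil = 0} i
                   | kronecker-diag {one = 1} {nil = 0} j
                   | kronecker-diag {one = 1} {nil = 0} q
                   | kronecker-off {one = 1} {nil = 0} (λ i'≡i → i≢i' (≡.sym i'≡i))
                   | kronecker-off {one = 1} {nil = 0} (λ j'≡j → j≢j' (≡.sym j'≡j)) = λ ()

  module _ {n₀ n₁ n₂ : ℕ} {A : HM K n₀ n₁ n₂} (generic : Generic K A) where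

    monomial≉0 : ∀ e → ¬ (evalMono K e A ≈ 0#)
    monomial≉0 e e≈0 =
      generic ((+ 1 , e) ∷ []) ((λ ()) , (λ ()) ∷ [] , [] ∷ []) (begin
        (1# + 0#) * evalMono K e A + 0#  ≈⟨ +-identityʳ _ ⟩
        (1# + 0#) * evalMono K e A       ≈⟨ *-congʳ (+-identityʳ 1#) ⟩
        1# * evalMono K e A              ≈⟨ *-identityˡ _ ⟩
        evalMono K e A                   ≈⟨ e≈0 ⟩
        0#                               ∎)

    monomial-injective : ∀ {e f} → ¬ (∀ i j k → e i j k ≡ f i j k) →
                         ¬ (evalMono K e A ≈ evalMono K f A)
    monomial-injective {e} {f} e≢f e≈f =
      generic ((+ 1 , e) ∷ (-[1+ 0 ] , f) ∷ [])
              ((λ ()) , ((λ ()) ∷ (λ ()) ∷ []) , ((e≢f ∷ []) ∷ [] ∷ [])) (begin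
        (1# + 0#) * evalMono K e A + (- (1# + 0#) * evalMono K f A + 0#)
          ≈⟨ +-cong (*-congʳ (+-identityʳ 1#))
                    (trans (+-identityʳ _) (*-congʳ (-‿cong (+-identityʳ 1#)))) ⟩
        1# * evalMono K e A + - 1# * evalMono K f A
          ≈⟨ +-cong (*-identityˡ _) (-1*x≈-x _) ⟩
        evalMono K e A - evalMono K f A
          ≈⟨ x≈y⇒x∙y⁻¹≈ε e≈f ⟩
        0# ∎)

    entry≉0 : ∀ x y z → ¬ (A x y z ≈ 0#)
    entry≉0 x y z Axyz≈0 =
      monomial≉0 (unitMono x y z) (trans (evalMono-unitMono A x y z) Axyz≈0)

    slice-minor≉0 : ∀ {i i' j j'} (q : Fin n₂) → i ≢ i' → j ≢ j' →
                    ¬ (A i j q * A i' j' q - A i j' q * A i' j q ≈ 0#)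
    slice-minor≉0 {i} {i'} {j} {j'} q i≢i' j≢j' minor≈0 =
      monomial-injective (slice-minor-monomials-distinct q i≢i' j≢j') (begin
        evalMono K (unitMono i j q +ᵐ unitMono i' j' q) A
          ≈⟨ evalMono-+ᵐ (unitMono i j q) (unitMono i' j' q) A ⟩
        evalMono K (unitMono i j q) A * evalMono K (unitMono i' j' q) A
          ≈⟨ *-cong (evalMono-unitMono A i j q) (evalMono-unitMono A i' j' q) ⟩
        A i j q * A i' j' q
          ≈⟨ x∙y⁻¹≈ε⇒x≈y _ _ minor≈0 ⟩
        A i j' q * A i' j q
          ≈⟨ sym (*-cong (evalMono-unitMono A i j' q) (evalMono-unitMono A i' j q)) ⟩
        evalMono K (unitMono i j' q) A * evalMono K (unitMono i' j q) A
          ≈⟨ sym (evalMono-+ᵐ (unitMono i j' q) (unitMono i' j q) A) ⟩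
        evalMono K (unitMono i j' q +ᵐ unitMono i' j q) A ∎)

  -- The solver only knows commutative semirings, so each identity is proved
  -- after adding its subtracted monomials to both sides.
  private
    cramer-expand : ∀ a b c d e f u w →
      (e * d - f * c) * u + (a * f - b * e) * w + (f * c * u + b * e * w)
        ≈ e * d * u + a * f * w
    cramer-expand a b c d e f u w = begin
      (e * d - f * c) * u + (a * f - b * e) * w + (f * c * u + b * e * w)
        ≈⟨ solve 8 (λ b c e f u w X Y →
                      X :* u :+ Y :* w :+ (f :* c :* u :+ b :* e :* w)
                   := (X :+ f :* c) :* u :+ (Y :+ b :* e) :* w)
                   refl b c e f u w (e * d - f * c) (a * f - b * e) ⟩
      (e * d - f * c + f * c) * u + (a * f - b * e + b * e) * w
        ≈⟨ +-cong (*-congʳ (//-rightDividesˡ (f * c) (e * d)))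
                  (*-congʳ (//-rightDividesˡ (b * e) (a * f))) ⟩
      e * d * u + a * f * w ∎

    expand-determinant : ∀ a b c d g → g * (a * d - b * c + b * c) ≈ g * (a * d)
    expand-determinant a b c d g = *-congˡ (//-rightDividesˡ (b * c) (a * d))

  cramer-identity₁ : ∀ a b c d e f →
    (e * d - f * c) * a + (a * f - b * e) * c ≈ e * (a * d - b * c)
  cramer-identity₁ a b c d e f = +-cancelʳ (f * c * a + b * e * c) _ _ (begin
    (e * d - f * c) * a + (a * f - b * e) * c + (f * c * a + b * e * c)
      ≈⟨ cramer-expand a b c d e f a c ⟩
    e * d * a + a * f * c
      ≈⟨ solve 5 (λ a c d e f → e :* d :* a :+ a :* f :* c := e :* (a :* d) :+ f :* c :* a)
                 refl a c d e f ⟩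
    e * (a * d) + f * c * a
      ≈⟨ +-congʳ (expand-determinant a b c d e) ⟨
    e * (a * d - b * c + b * c) + f * c * a
      ≈⟨ solve 6 (λ b c e f a Δ → e :* (Δ :+ b :* c) :+ f :* c :* a
                              := e :* Δ :+ (f :* c :* a :+ b :* e :* c))
                 refl b c e f a (a * d - b * c) ⟩
    e * (a * d - b * c) + (f * c * a + b * e * c) ∎)

  cramer-identity₂ : ∀ a b c d e f →
    (e * d - f * c) * b + (a * f - b * e) * d ≈ f * (a * d - b * c)
  cramer-identity₂ a b c d e f = +-cancelʳ (f * c * b + b * e * d) _ _ (begin
    (e * d - f * c) * b + (a * f - b * e) * d + (f * c * b + b * e * d)
      ≈⟨ cramer-expand a b c d e f b d ⟩
    e * d * b + a * f * d
      ≈⟨ solve 5 (λ a b d e f → e :* d :* b :+ a :* f :* d := f :* (a :* d) :+ b :* e :* d)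
                 refl a b d e f ⟩
    f * (a * d) + b * e * d
      ≈⟨ +-congʳ (expand-determinant a b c d f) ⟨
    f * (a * d - b * c + b * c) + b * e * d
      ≈⟨ solve 6 (λ b c d e f Δ → f :* (Δ :+ b :* c) :+ b :* e :* d
                              := f :* Δ :+ (f :* c :* b :+ b :* e :* d))
                 refl b c d e f (a * d - b * c) ⟩
    f * (a * d - b * c) + (f * c * b + b * e * d) ∎)

  cramer₂ : IsField K → ∀ {a b c d} → ¬ (a * d - b * c ≈ 0#) → ∀ e f →
            ∃₂ λ x y → x * a + y * c ≈ e × x * b + y * d ≈ f
  cramer₂ (_ , inverse) {a} {b} {c} {d} Δ≉0 e f with inverse (a * d - b * c) Δ≉0
  ... | Δ⁻¹ , ΔΔ⁻¹≈1 =
    (e * d - f * c) * Δ⁻¹ , (a * f - b * e) * Δ⁻¹ ,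
    divide (cramer-identity₁ a b c d e f) , divide (cramer-identity₂ a b c d e f)
    where
    divide : ∀ {X Y u w g} → X * u + Y * w ≈ g * (a * d - b * c) →
             X * Δ⁻¹ * u + Y * Δ⁻¹ * w ≈ g
    divide {X} {Y} {u} {w} {g} eq = begin
      X * Δ⁻¹ * u + Y * Δ⁻¹ * w
        ≈⟨ solve 5 (λ X Y u w i → X :* i :* u :+ Y :* i :* w := (X :* u :+ Y :* w) :* i)
                   refl X Y u w Δ⁻¹ ⟩
      (X * u + Y * w) * Δ⁻¹            ≈⟨ *-congʳ eq ⟩
      g * (a * d - b * c) * Δ⁻¹        ≈⟨ *-assoc g _ Δ⁻¹ ⟩
      g * ((a * d - b * c) * Δ⁻¹)      ≈⟨ *-congˡ ΔΔ⁻¹≈1 ⟩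
      g * 1#                           ≈⟨ *-identityʳ g ⟩
      g                                ∎

  first-unknown≉0 : ∀ {a b c d e f x y} → x * a + y * c ≈ e → x * b + y * d ≈ f →
                    ¬ (e * d - f * c ≈ 0#) → ¬ (x ≈ 0#)
  first-unknown≉0 {c = c} {d} {e} {f} {x} {y} eq₁ eq₂ minor≉0 x≈0 =
    minor≉0 (x≈y⇒x∙y⁻¹≈ε (begin
      e * d        ≈⟨ *-congʳ (drop-first eq₁) ⟩
      y * c * d    ≈⟨ solve 3 (λ y c d → y :* c :* d := y :* d :* c) refl y c d ⟩
      y * d * c    ≈⟨ *-congʳ (drop-first eq₂) ⟨
      f * c        ∎))
    where
    drop-first : ∀ {u w g} → x * u + y * w ≈ g → g ≈ y * w
    drop-first {u} {w} {g} eq = begin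
      g              ≈⟨ eq ⟨
      x * u + y * w  ≈⟨ +-congʳ (trans (*-congʳ x≈0) (zeroˡ u)) ⟩
      0# + y * w     ≈⟨ +-identityˡ _ ⟩
      y * w          ∎

  bmRank≤-rows : ∀ {n₀ n₁ n₂} (A : HM K n₀ n₁ n₂) → BMRank≤ K A n₀
  bmRank≤-rows {n₀} A = n₀ , ≤-refl , (λ i j _ → δ j i) , (λ _ _ _ → 1#) , A ,
    λ i c q → trans (Σᶠ-cong n₀ (λ j → *-congʳ (*-identityʳ (δ j i))))
                    (Σᶠ-δ i (λ j → A j c q))

  module Decomposition {k n₂ : ℕ} (B : HM K (suc (suc (suc k))) (suc (suc (suc k))) n₂)
    (φ v ψ : Fin n₂ → Carrier) (σ : Fin (suc k) → Fin n₂ → Carrier)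
    (solves₀ : ∀ q → φ q * B 0F 0F q + v q * B 2F 0F q ≈ B 1F 0F q)
    (solves₁ : ∀ q → φ q * B 0F 1F q + v q * B 2F 1F q ≈ B 1F 1F q)
    (φψ≈1 : ∀ q → φ q * ψ q ≈ 1#)
    (Bσ≈1 : ∀ p q → B (suc (suc p)) (suc (suc p)) q * σ p q ≈ 1#)
    where

    T : Fin (suc (suc (suc k))) → Fin n₂ → Carrier
    T 0F            q = B 0F 0F q
    T 1F            q = B 0F 1F q
    T (suc (suc c)) q = ψ q * B 1F (suc (suc c)) q

    X₀ : HM K (suc (suc (suc k))) (suc (suc k)) n₂
    X₀ 0F            0F            q = 1#
    X₀ 0F            (suc p)       q = (B 0F (suc (suc p)) q - T (suc (suc p)) q) * σ p q
    X₀ 1F            0F            q = φ q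
    X₀ 1F            1F            q = v q
    X₀ 1F            (suc (suc _)) q = 0#
    X₀ (suc (suc i)) 0F            q = 0#
    X₀ (suc (suc i)) (suc p)       q = δ p i

    X₁ : HM K (suc (suc (suc k))) (suc (suc (suc k))) (suc (suc k))
    X₁ _             _             0F      = 1#
    X₁ 0F            (suc (suc c)) (suc p) = δ p c
    X₁ 0F            _             (suc p) = 0#
    X₁ 1F            (suc (suc c)) (suc p) = 0#
    X₁ 1F            _             (suc p) = 1#
    X₁ (suc (suc i)) _             (suc p) = 1#

    X₂ : HM K (suc (suc k)) (suc (suc (suc k))) n₂
    X₂ 0F      c q = T c q
    X₂ (suc p) c q = B (suc (suc p)) c q

    private
      row₁-tail≈0 : ∀ c q → Σᶠ K k (λ p → X₀ 1F (suc (suc p)) q * X₁ 1F c (suc (suc p))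
                                          * X₂ (suc (suc p)) c q) ≈ 0#
      row₁-tail≈0 c q = Σᶠ-zero k (λ p → 0*x*y≈0 (X₁ 1F c (suc (suc p))) (X₂ (suc (suc p)) c q))

      row₀-tail≈0 : ∀ c q → Σᶠ K (suc k) (λ p → X₀ 0F (suc p) q * 0# * X₂ (suc p) c q) ≈ 0#
      row₀-tail≈0 c q = Σᶠ-zero (suc k) (λ p → x*0*y≈0 (X₀ 0F (suc p) q) (X₂ (suc p) c q))

      column₀₁ : ∀ c q → 1# * T c q + 0# ≈ T c q
      column₀₁ c q = trans (+-identityʳ _) (*-identityˡ _)

    row₀ : ∀ c q → Prod K X₀ X₁ X₂ 0F c q ≈ B 0F c q
    row₀ 0F q = trans (+-cong (x*1*y≈x*y 1# _) (row₀-tail≈0 0F q)) (column₀₁ 0F q)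
    row₀ 1F q = trans (+-cong (x*1*y≈x*y 1# _) (row₀-tail≈0 1F q)) (column₀₁ 1F q)
    row₀ (suc (suc c)) q = begin
      1# * 1# * T c′ q
        + Σᶠ K (suc k) (λ p → X₀ 0F (suc p) q * δ p c * B (suc (suc p)) c′ q)
        ≈⟨ +-cong (trans (x*1*y≈x*y 1# _) (*-identityˡ _))
                  (Σᶠ-cong (suc k) λ p → xy∙z≈y∙xz (X₀ 0F (suc p) q) (δ p c) (X₂ (suc p) c′ q)) ⟩
      T c′ q + Σᶠ K (suc k) (λ p → δ p c * (X₀ 0F (suc p) q * B (suc (suc p)) c′ q))
        ≈⟨ +-congˡ (Σᶠ-δ c (λ p → X₀ 0F (suc p) q * B (suc (suc p)) c′ q)) ⟩
      T c′ q + (B 0F c′ q - T c′ q) * σ c q * B c′ c′ q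
        ≈⟨ +-congˡ (trans (*-assoc _ _ _) (*-congˡ (trans (*-comm _ _) (Bσ≈1 c q)))) ⟩
      T c′ q + (B 0F c′ q - T c′ q) * 1#
        ≈⟨ +-congˡ (*-identityʳ _) ⟩
      T c′ q + (B 0F c′ q - T c′ q)
        ≈⟨ +-comm _ _ ⟩
      B 0F c′ q - T c′ q + T c′ q
        ≈⟨ //-rightDividesˡ (T c′ q) (B 0F c′ q) ⟩
      B 0F c′ q ∎
      where c′ = suc (suc c)

    row₁ : ∀ c q → Prod K X₀ X₁ X₂ 1F c q ≈ B 1F c q
    row₁ 0F q = trans (+-cong (x*1*y≈x*y _ _)
                              (trans (+-cong (x*1*y≈x*y _ _) (row₁-tail≈0 0F q)) (+-identityʳ _)))
                      (solves₀ q)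
    row₁ 1F q = trans (+-cong (x*1*y≈x*y _ _)
                              (trans (+-cong (x*1*y≈x*y _ _) (row₁-tail≈0 1F q)) (+-identityʳ _)))
                      (solves₁ q)
    row₁ (suc (suc c)) q = begin
      φ q * 1# * (ψ q * B 1F c′ q) + (v q * 0# * B 2F c′ q + Σᶠ K k _)
        ≈⟨ +-cong (x*1*y≈x*y _ _)
                  (trans (+-cong (x*0*y≈0 _ _) (row₁-tail≈0 c′ q)) (+-identityʳ 0#)) ⟩
      φ q * (ψ q * B 1F c′ q) + 0#
        ≈⟨ +-identityʳ _ ⟩
      φ q * (ψ q * B 1F c′ q)
        ≈⟨ *-assoc _ _ _ ⟨
      φ q * ψ q * B 1F c′ q
        ≈⟨ *-congʳ (φψ≈1 q) ⟩
      1# * B 1F c′ q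
        ≈⟨ *-identityˡ _ ⟩
      B 1F c′ q ∎
      where c′ = suc (suc c)

    row₂₊ : ∀ i c q → Prod K X₀ X₁ X₂ (suc (suc i)) c q ≈ B (suc (suc i)) c q
    row₂₊ i c q =
      trans (+-cong (0*x*y≈0 _ _) (Σᶠ-cong (suc k) λ p → x*1*y≈x*y (δ p i) (X₂ (suc p) c q)))
            (trans (+-identityˡ _) (Σᶠ-δ i (λ p → B (suc (suc p)) c q)))

    Prod≈B : ∀ i c q → Prod K X₀ X₁ X₂ i c q ≈ B i c q
    Prod≈B 0F             = row₀
    Prod≈B 1F             = row₁
    Prod≈B (suc (suc i))  = row₂₊ i

  generic⇒bmRank≤-pred-rows : IsField K → ∀ {k n₂} (B : HM K (suc (suc (suc k))) (suc (suc (suc k))) n₂) →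
                 Generic K B → BMRank≤ K B (suc (suc k))
  generic⇒bmRank≤-pred-rows isField {k} {n₂} B generic =
    suc (suc k) , ≤-refl , D.X₀ , D.X₁ , D.X₂ , D.Prod≈B
    where
    system : ∀ q → ∃₂ λ x y → x * B 0F 0F q + y * B 2F 0F q ≈ B 1F 0F q
                             × x * B 0F 1F q + y * B 2F 1F q ≈ B 1F 1F q
    system q = cramer₂ isField (slice-minor≉0 generic q (λ ()) (λ ())) (B 1F 0F q) (B 1F 1F q)

    φ v : Fin n₂ → Carrier
    φ q = proj₁ (system q)
    v q = proj₁ (proj₂ (system q))

    φ≉0 : ∀ q → ¬ (φ q ≈ 0#)
    φ≉0 q = first-unknown≉0 (proj₁ (proj₂ (proj₂ (system q))))
                            (proj₂ (proj₂ (proj₂ (system q))))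
                            (slice-minor≉0 generic q (λ ()) (λ ()))

    φ⁻¹ : ∀ q → ∃ λ y → φ q * y ≈ 1#
    φ⁻¹ q = proj₂ isField (φ q) (φ≉0 q)

    diagonal⁻¹ : ∀ p q → ∃ λ y → B (suc (suc p)) (suc (suc p)) q * y ≈ 1#
    diagonal⁻¹ p q = proj₂ isField _ (entry≉0 generic (suc (suc p)) (suc (suc p)) q)

    module D = Decomposition B φ v (λ q → proj₁ (φ⁻¹ q)) (λ p q → proj₁ (diagonal⁻¹ p q))
                 (λ q → proj₁ (proj₂ (proj₂ (system q))))
                 (λ q → proj₂ (proj₂ (proj₂ (system q))))
                 (λ q → proj₂ (φ⁻¹ q))
                 (λ p q → proj₂ (diagonal⁻¹ p q))

theorem7 : {c ℓ : Level} (K : CommutativeRing c ℓ) →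
    IsField K → IsAlgClosed K → Char0 K →
    (n : ℕ) → 2 ≤ n → (B : HM K n n n) → Generic K B →
    (n ≡ 2 → BMRank≤ K B 2) ×
    (3 ≤ n → BMRank≤ K B (n ∸ 1))
theorem7 _ _ _ _ 1 (s≤s ()) _ _
theorem7 K _ _ _ 2 _ B _ = (λ _ → bmRank≤-rows K B) , λ { (s≤s (s≤s ())) }
theorem7 K isField _ _ (suc (suc (suc k))) _ B generic =
  (λ ()) , λ _ → generic⇒bmRank≤-pred-rows K isField B generic
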